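{- Let $p$ be a prime and define $T:\mathbb{Q}\to\mathbb{Q}$ by $T(0)=0$ and, for $\alpha\ne0$, $T(\alpha)=\frac{ -p^{\mathrm{ord}_p(\alpha)}}{\alpha}-\omega_p\!\left(\frac{ -p^{\mathrm{ord}_p(\alpha)}}{\alpha}\right)$. Then for every rational number $\alpha$ there is $m\ge0$ with $T^m(\alpha)=0$ (i.e. $\alpha$ has a finite $\Phi_0^{[-1]}$ continued fraction expansion).
   Context: For $\beta\in\mathbb{Q}_p\setminus\{0\}$ with $p$-adic expansion $\beta=\sum_{n\in\mathbb{Z}}c_np^n$, $c_n\in\{0,1,\dots,p-1\}$: $\mathrm{ord}_p(\beta)=\min\{n:c_n\ne0\}$ and $\omega_p(\beta)=c_0$. -}

module Defs where

open import Data.Nat as ℕ using (ℕ; zero; suc; NonZero; _^_; _∸_)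
open import Data.Nat.Properties using (m^n≢0)
open import Data.Nat.DivMod using (_/_; _%_)
open import Data.Integer as ℤ using (ℤ; +_; -[1+_])
open import Data.Rational as ℚ using (ℚ; 0ℚ; ↥_; ↧ₙ_; ≢-nonZero)
open import Data.Rational.Properties using (_≟_)
open import Data.List.Base using (find; upTo)
open import Data.Maybe.Base using (just; nothing)
open import Data.Bool.Base using (if_then_else_; _∧_; not)
open import Relation.Nullary using (yes; no)

-- p-adic valuation of a natural number (v_p(0) = 0 by convention, never used
-- on 0 below).  Fuel n suffices since p ≥ 2 for the primes we care about.
vAux : (p : ℕ) .{{_ : NonZero p}} → ℕ → ℕ → ℕ
vAux p zero    n = 0
vAux p (suc f) n =
  if (n % p ℕ.≡ᵇ 0) ∧ not (n ℕ.≡ᵇ 0) then suc (vAux p f (n / p)) else 0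

vₚ : (p : ℕ) .{{_ : NonZero p}} → ℕ → ℕ
vₚ p n = vAux p n n

ordₚ : (p : ℕ) .{{_ : NonZero p}} → ℚ → ℤ
ordₚ p α = (+ vₚ p ℤ.∣ ↥ α ∣) ℤ.- (+ vₚ p (↧ₙ α))

powℚ : (p : ℕ) .{{_ : NonZero p}} → ℤ → ℚ
powℚ p (+ k)      = (+ (p ^ k)) ℚ./ 1
powℚ p -[1+ k ]   = ℚ._/_ (+ 1) (p ^ suc k) ⦃ m^n≢0 p (suc k) ⦄

-- ω_p(β) = c₀, the coefficient of p⁰ in the p-adic expansion of β = n/d.
-- Write d = p^e d' with p ∤ d'.  Then p^e β = n/d' ∈ ℤ_(p); letting
-- r ∈ [0, p^(e+1)) be its residue mod p^(e+1) (d' r ≡ n mod p^(e+1)),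
-- c₀ is the digit of p^e in r, i.e. ⌊r / p^e⌋.
ωₚ : (p : ℕ) .{{_ : NonZero p}} → ℚ → ℕ
ωₚ p β with find (λ r → (((+ d') ℤ.* (+ r) ℤ.- n) ℤ.%ℕ M) ℕ.≟ 0) (upTo M)
  where
    n  = ↥ β
    d  = ↧ₙ β
    e  = vₚ p d
    d' = _/_ d (p ^ e) ⦃ m^n≢0 p e ⦄
    M  = p ^ suc e
    instance _ = m^n≢0 p (suc e)
... | just r  = _/_ r (p ^ vₚ p (↧ₙ β)) ⦃ m^n≢0 p (vₚ p (↧ₙ β)) ⦄
... | nothing = 0

T : (p : ℕ) .{{_ : NonZero p}} → ℚ → ℚ
T p α with α ≟ 0ℚ
... | yes _  = 0ℚ
... | no α≢0 = β ℚ.- ((+ ωₚ p β) ℚ./ 1)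
  where
    β = ℚ.- (ℚ._÷_ (powℚ p (ordₚ p α)) α ⦃ ≢-nonZero α≢0 ⦄)

iter : {A : Set} → (A → A) → ℕ → A → A
iter f zero    x = x
iter f (suc m) x = f (iter f m x)

module Submission where

-- Let α = n/d ≠ 0 in lowest terms and write |n| = u·p^a, d = d'·p^e with p ∤ u, d'.
-- Then β = -p^(ord α)/α = -σ·d'/u, where σ = ±1 is the sign of n; this is again in
-- lowest terms and has denominator prime to p, so its digit ω_p(β) is the residue
-- c < p of β modulo p, and T α = β - c = x/u with x = -σ·d' - c·u divisible by p.
-- Measure α by  μ(α) = 2·(d + p·u) + [n > 0].  Since p·(p-free part of |x|) ≤ |x|:
--   n > 0:  x = -(d' + c·u) < 0 and  u + |x| ≤ d + p·u,
--   n < 0:  x = d' - c·u         and  u + |x| < d + p·u,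
-- so μ(T α) < μ(α), and T reaches 0 by well-founded induction on μ.
open import Defs
open import Data.Nat as ℕ using (ℕ; zero; suc; _^_; _∸_; NonZero; z≤n; s≤s; _≤_; _<_; _*_; _+_)
import Data.Nat.Properties as ℕP
open import Data.Nat.DivMod using (_/_; _%_; n/1≡n; m≡m%n+[m/n]*n; m*n/n≡m; m/n≤m; m/n<m)
open import Data.Nat.Divisibility using (divides; _∣_; n∣m⇒m%n≡0; ∣-trans)
open import Data.Nat.Induction using (<-rec)
open import Data.Bool.Base using (true; false) renaming (T to True)
open import Data.Sum using (_⊎_; inj₁; inj₂)
open import Data.Product using (_×_; _,_; proj₁; proj₂; ∃-syntax)
open import Data.Empty using (⊥-elim)
open import Relation.Binary.PropositionalEquality
open import Relation.Nullary using (¬_; Dec; yes; no)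
open import Relation.Unary using (Decidable)
open import Function.Base using (_∘_)
open import Function.Bundles using (_⇔_; mk⇔; Equivalence)
open import Data.Integer as ℤ using (ℤ; +_; -[1+_]; +[1+_]; 1ℤ)
import Data.Integer.Properties as ℤP
open import Data.Integer.DivMod using (_%ℕ_; _/ℕ_; a≡a%ℕn+[a/ℕn]*n; n%ℕd<d)
open import Data.Integer.Divisibility.Signed as ℤ∣ using (∣⇒∣ᵤ; ∣ᵤ⇒∣; ∣m∣n⇒∣m+n; ∣m⇒∣-m; ∣-refl; ∣m∣n⇒∣m-n; ∣m⇒∣m*n; ∣n⇒∣m*n)
open import Data.Integer.Tactic.RingSolver using (solve-∀)
open import Data.Nat.Coprimality as Coprimality using (Coprime; coprime-Bézout)
open import Data.Nat.GCD using (module Bézout)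
open import Data.Nat.Primality using (Prime; prime⇒irreducible; prime⇒nonTrivial)
open import Data.List.Base using (List; _∷_; find)
open import Data.List.Membership.Propositional using (_∈_)
open import Data.List.Membership.Propositional.Properties using (∈-upTo⁺; ∈-upTo⁻)
open import Data.List.Relation.Unary.Any using (here; there)
open import Data.Maybe.Base using (just)
open import Data.Rational as ℚ using (ℚ; mkℚ; ↥_; ↧ₙ_; 0ℚ; toℚᵘ)
import Data.Rational.Properties as ℚP
open import Data.Rational.Unnormalised as ℚᵘ using (mkℚᵘ; *≡*; _≃_) renaming (_/_ to _/ᵘ_)
import Data.Rational.Unnormalised.Properties as ℚᵘP

iter-shift : {A : Set} (f : A → A) (m : ℕ) (x : A) → iter f m (f x) ≡ iter f (suc m) x
iter-shift f zero    x = refl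
iter-shift f (suc m) x = cong f (iter-shift f m x)

iter-reaches : {A : Set} (f : A → A) (z : A) → ((x : A) → Dec (x ≡ z)) →
               (μ : A → ℕ) → ((x : A) → x ≢ z → μ (f x) < μ x) →
               (x : A) → ∃[ m ] iter f m x ≡ z
iter-reaches {A} f z _≟z μ decrease x = <-rec Goal step (μ x) x refl
  where
  Goal : ℕ → Set
  Goal k = (x : A) → μ x ≡ k → ∃[ m ] iter f m x ≡ z
  step : (k : ℕ) → (∀ {j} → j < k → Goal j) → Goal k
  step k ih x refl with x ≟z
  ... | yes x≡z = 0 , x≡z
  ... | no  x≢z with ih (decrease x x≢z) (f x) refl
  ...   | m , fᵐ⁺¹x≡z = suc m , trans (sym (iter-shift f m x)) fᵐ⁺¹x≡z

find-complete : {A : Set} {P : A → Set} (P? : Decidable P) {xs : List A} {x : A} →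
                x ∈ xs → P x → ∃[ r ] find P? xs ≡ just r × r ∈ xs × P r
find-complete P? {y ∷ xs} x∈ Px with P? y
... | yes Py = y , refl , here refl , Py
find-complete P? {y ∷ xs} (here refl) Px | no ¬Py = ⊥-elim (¬Py Px)
find-complete P? {y ∷ xs} (there x∈)  Px | no _
  with find-complete P? x∈ Px
... | r , found , r∈ , Pr = r , found , there r∈ , Pr

%ℕ≡0⇒∣ : ∀ z M .{{_ : NonZero M}} → z %ℕ M ≡ 0 → + M ℤ∣.∣ z
%ℕ≡0⇒∣ z M z%M≡0 = ℤ∣.divides (z /ℕ M) (begin
  z                         ≡⟨ a≡a%ℕn+[a/ℕn]*n z M ⟩
  + (z %ℕ M) ℤ.+ z /ℕ M ℤ.* + M ≡⟨ cong (λ r → + r ℤ.+ z /ℕ M ℤ.* + M) z%M≡0 ⟩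
  + 0 ℤ.+ z /ℕ M ℤ.* + M    ≡⟨ ℤP.+-identityˡ _ ⟩
  z /ℕ M ℤ.* + M            ∎)
  where open ≡-Reasoning

∣⇒%ℕ≡0 : ∀ z M .{{_ : NonZero M}} → + M ℤ∣.∣ z → z %ℕ M ≡ 0
∣⇒%ℕ≡0 (+ n)    M M∣z = n∣m⇒m%n≡0 n M (∣⇒∣ᵤ M∣z)
∣⇒%ℕ≡0 -[1+ n ] M M∣z with suc n % M | n∣m⇒m%n≡0 (suc n) M (∣⇒∣ᵤ M∣z)
... | zero | _ = refl

as-ℤ : ∀ a b c d e → a + b * c ≡ d * e → + a ℤ.+ + b ℤ.* + c ≡ + d ℤ.* + e
as-ℤ a b c d e eq = begin
  + a ℤ.+ + b ℤ.* + c  ≡⟨ cong (λ t → + a ℤ.+ t) (ℤP.pos-* b c) ⟨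
  + (a + b * c)        ≡⟨ cong +_ eq ⟩
  + (d * e)            ≡⟨ ℤP.pos-* d e ⟩
  + d ℤ.* + e          ∎
  where open ≡-Reasoning

pos-*-≡ : ∀ m n k l → m * n ≡ k * l → + m ℤ.* + n ≡ + k ℤ.* + l
pos-*-≡ m n k l eq = trans (sym (ℤP.pos-* m n)) (trans (cong +_ eq) (ℤP.pos-* k l))

coprime-divisors : ∀ {m n a b} → Coprime m n → a ∣ m → b ∣ n → Coprime a b
coprime-divisors m⊥n a∣m b∣n (k∣a , k∣b) = m⊥n (∣-trans k∣a a∣m , ∣-trans k∣b b∣n)

coprime-shift : ∀ i c u → Coprime ℤ.∣ i ∣ u → Coprime ℤ.∣ i ℤ.- + c ℤ.* + u ∣ u
coprime-shift i c u i⊥u {k} (k∣i-cu , k∣u) = i⊥u (∣⇒∣ᵤ k∣i , k∣u)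
  where
  shift-back : ∀ I C U → I ℤ.- C ℤ.* U ℤ.+ C ℤ.* U ≡ I
  shift-back = solve-∀
  k∣i : + k ℤ∣.∣ i
  k∣i = subst (+ k ℤ∣.∣_) (shift-back i (+ c) (+ u))
          (∣m∣n⇒∣m+n (∣ᵤ⇒∣ {+ k} {i ℤ.- + c ℤ.* + u} k∣i-cu) (∣n⇒∣m*n (+ c) (∣ᵤ⇒∣ {+ k} {+ u} k∣u)))

module Valuation (p : ℕ) .{{_ : NonZero p}} (1<p : 1 < p) where

  vAux-factorisation : ∀ f n → 0 < n → n ≤ f →
                       ∃[ m ] n ≡ m * p ^ vAux p f n × ¬ p ∣ m
  vAux-factorisation zero    n       0<n n≤0 = ⊥-elim (ℕP.<⇒≱ 0<n n≤0)
  vAux-factorisation (suc f) (suc k) 0<n n≤f with suc k % p ℕ.≡ᵇ 0 in eq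
  ... | false = suc k , sym (ℕP.*-identityʳ (suc k)) ,
                λ p∣n → subst True eq (ℕP.≡⇒≡ᵇ _ _ (n∣m⇒m%n≡0 _ _ p∣n))
  ... | true  = m , n≡m*pᵛ⁺¹ , p∤m
    where
    n = suc k
    n≡[n/p]*p : n ≡ n / p * p
    n≡[n/p]*p = trans (m≡m%n+[m/n]*n n p)
                      (cong (_+ n / p * p) (ℕP.≡ᵇ⇒≡ _ _ (subst True (sym eq) _)))
    0<n/p : 0 < n / p
    0<n/p with n / p | n≡[n/p]*p
    ... | suc _ | _ = s≤s z≤n
    ih = vAux-factorisation f (n / p) 0<n/p
           (ℕP.≤-pred (ℕP.≤-trans (m/n<m n p 1<p) n≤f))
    m = proj₁ ih
    v = vAux p f (n / p)
    p∤m = proj₂ (proj₂ ih)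
    n≡m*pᵛ⁺¹ : n ≡ m * p ^ suc v
    n≡m*pᵛ⁺¹ = begin
      n                ≡⟨ n≡[n/p]*p ⟩
      n / p * p        ≡⟨ cong (_* p) (proj₁ (proj₂ ih)) ⟩
      m * p ^ v * p    ≡⟨ ℕP.*-assoc m (p ^ v) p ⟩
      m * (p ^ v * p)  ≡⟨ cong (m *_) (ℕP.*-comm (p ^ v) p) ⟩
      m * p ^ suc v    ∎
      where open ≡-Reasoning

  -- The p-free part of n: n with every factor p removed (unit 0 = 0).
  unit : ℕ → ℕ
  unit n = _/_ n (p ^ vₚ p n) {{ℕP.m^n≢0 p (vₚ p n)}}

  unit-factorisation : ∀ {n} → 0 < n → n ≡ unit n * p ^ vₚ p n × ¬ p ∣ unit n
  unit-factorisation {n} 0<n with vAux-factorisation n n 0<n ℕP.≤-refl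
  ... | m , n≡m*pᵛ , p∤m = subst (λ k → n ≡ k * p ^ vₚ p n × ¬ p ∣ k) (sym unit≡m) (n≡m*pᵛ , p∤m)
    where
    unit≡m : unit n ≡ m
    unit≡m = trans (cong (λ k → _/_ k (p ^ vₚ p n) {{ℕP.m^n≢0 p (vₚ p n)}}) n≡m*pᵛ)
                   (m*n/n≡m m (p ^ vₚ p n) {{ℕP.m^n≢0 p (vₚ p n)}})

  unit-≤ : ∀ n → unit n ≤ n
  unit-≤ n = m/n≤m n (p ^ vₚ p n) {{ℕP.m^n≢0 p (vₚ p n)}}

  unit-∣ : ∀ {n} → 0 < n → unit n ∣ n
  unit-∣ {n} 0<n = divides (p ^ vₚ p n)
    (trans (proj₁ (unit-factorisation 0<n)) (ℕP.*-comm (unit n) (p ^ vₚ p n)))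

  unit-nonZero : ∀ {n} → 0 < n → NonZero (unit n)
  unit-nonZero {n} 0<n = ℕ.≢-nonZero λ u≡0 →
    ℕP.<⇒≢ 0<n (sym (trans (proj₁ (unit-factorisation 0<n)) (cong (_* p ^ vₚ p n) u≡0)))

  unit-factorisation-cases : ∀ {n} → 0 < n →
    (vₚ p n ≡ 0 × n ≡ unit n) ⊎ ∃[ w ] n ≡ unit n * p ^ w * p
  unit-factorisation-cases {n} 0<n = split (vₚ p n) refl
    where
    open ≡-Reasoning
    split : ∀ v → vₚ p n ≡ v → (vₚ p n ≡ 0 × n ≡ unit n) ⊎ ∃[ w ] n ≡ unit n * p ^ w * p
    split zero    v≡0   = inj₁ (v≡0 , (begin
      n                    ≡⟨ proj₁ (unit-factorisation 0<n) ⟩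
      unit n * p ^ vₚ p n  ≡⟨ cong (λ k → unit n * p ^ k) v≡0 ⟩
      unit n * 1           ≡⟨ ℕP.*-identityʳ (unit n) ⟩
      unit n               ∎))
    split (suc w) v≡w+1 = inj₂ (w , (begin
      n                     ≡⟨ proj₁ (unit-factorisation 0<n) ⟩
      unit n * p ^ vₚ p n   ≡⟨ cong (λ k → unit n * p ^ k) v≡w+1 ⟩
      unit n * (p * p ^ w)  ≡⟨ cong (unit n *_) (ℕP.*-comm p (p ^ w)) ⟩
      unit n * (p ^ w * p)  ≡⟨ ℕP.*-assoc (unit n) (p ^ w) p ⟨
      unit n * p ^ w * p    ∎))

  vₚ-unit : ∀ {n} → 0 < n → ¬ p ∣ n → vₚ p n ≡ 0
  vₚ-unit {n} 0<n p∤n with unit-factorisation-cases 0<n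
  ... | inj₁ (v≡0 , _)     = v≡0
  ... | inj₂ (w , n≡u*pʷ*p) = ⊥-elim (p∤n (divides (unit n * p ^ w) n≡u*pʷ*p))

  p*unit≤ : ∀ n → p ∣ n → p * unit n ≤ n
  p*unit≤ zero    _   = ℕP.≤-reflexive (ℕP.*-zeroʳ p)
  p*unit≤ (suc k) p∣n with unit-factorisation-cases (s≤s (z≤n {k}))
  ... | inj₁ (_ , n≡u)     = ⊥-elim (proj₂ (unit-factorisation (s≤s (z≤n {k}))) (subst (p ∣_) n≡u p∣n))
  ... | inj₂ (w , n≡u*pʷ*p) = begin
    p * unit n          ≡⟨ ℕP.*-comm p (unit n) ⟩
    unit n * p          ≤⟨ ℕP.*-monoˡ-≤ p (ℕP.m≤m*n (unit n) (p ^ w) {{ℕP.m^n≢0 p w}}) ⟩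
    unit n * p ^ w * p  ≡⟨ n≡u*pʷ*p ⟨
    n                   ∎
    where
    n = suc k
    open ℕP.≤-Reasoning

module Residues (p : ℕ) .{{_ : NonZero p}} (p-prime : Prime p) where

  coprime-to-p : ∀ {u} → ¬ p ∣ u → Coprime p u
  coprime-to-p p∤u (i∣p , i∣u) with prime⇒irreducible p-prime i∣p
  ... | inj₁ i≡1 = i≡1
  ... | inj₂ refl = ⊥-elim (p∤u i∣u)

  inverse-mod : ∀ {u} → ¬ p ∣ u → ∃[ w ] + p ℤ∣.∣ + u ℤ.* w ℤ.- 1ℤ
  inverse-mod {u} p∤u with coprime-Bézout (coprime-to-p p∤u)
  ... | Bézout.+- x y 1+yu≡xp = ℤ.- + y , ℤ∣.divides (ℤ.- + x) (begin
    + u ℤ.* ℤ.- + y ℤ.- 1ℤ        ≡⟨ negate-shift (+ u) (+ y) ⟩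
    ℤ.- (1ℤ ℤ.+ + y ℤ.* + u)      ≡⟨ cong ℤ.-_ (as-ℤ 1 y u x p 1+yu≡xp) ⟩
    ℤ.- (+ x ℤ.* + p)             ≡⟨ ℤP.neg-distribˡ-* (+ x) (+ p) ⟩
    ℤ.- + x ℤ.* + p               ∎)
    where
    open ≡-Reasoning
    negate-shift : ∀ U Y → U ℤ.* ℤ.- Y ℤ.- 1ℤ ≡ ℤ.- (1ℤ ℤ.+ Y ℤ.* U)
    negate-shift = solve-∀
  ... | Bézout.-+ x y 1+xp≡yu = + y , ℤ∣.divides (+ x) (begin
    + u ℤ.* + y ℤ.- 1ℤ             ≡⟨ cong (ℤ._- 1ℤ) (ℤP.*-comm (+ u) (+ y)) ⟩
    + y ℤ.* + u ℤ.- 1ℤ             ≡⟨ cong (ℤ._- 1ℤ) (as-ℤ 1 x p y u 1+xp≡yu) ⟨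
    1ℤ ℤ.+ + x ℤ.* + p ℤ.- 1ℤ      ≡⟨ cancel-one (+ x ℤ.* + p) ⟩
    + x ℤ.* + p                    ∎)
    where
    open ≡-Reasoning
    cancel-one : ∀ Z → 1ℤ ℤ.+ Z ℤ.- 1ℤ ≡ Z
    cancel-one = solve-∀

  residue : ∀ {u} → ¬ p ∣ u → ∀ y → ∃[ r ] r < p × + p ℤ∣.∣ + u ℤ.* + r ℤ.- y
  residue {u} p∤u y with inverse-mod p∤u
  ... | w , p∣uw-1 = r , n%ℕd<d (w ℤ.* y) p , (begin
    + p                                          ∣⟨ ∣m∣n⇒∣m-n (∣m⇒∣m*n y p∣uw-1) (∣n⇒∣m*n (+ u ℤ.* q) ∣-refl) ⟩
    (+ u ℤ.* w ℤ.- 1ℤ) ℤ.* y ℤ.- + u ℤ.* q ℤ.* + p ≡⟨ expand (+ u) w y q (+ p) ⟩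
    + u ℤ.* (w ℤ.* y) ℤ.- y ℤ.- + u ℤ.* q ℤ.* + p  ≡⟨ cong (λ t → + u ℤ.* t ℤ.- y ℤ.- + u ℤ.* q ℤ.* + p) (a≡a%ℕn+[a/ℕn]*n (w ℤ.* y) p) ⟩
    + u ℤ.* (+ r ℤ.+ q ℤ.* + p) ℤ.- y ℤ.- + u ℤ.* q ℤ.* + p ≡⟨ collapse (+ u) (+ r) q (+ p) y ⟩
    + u ℤ.* + r ℤ.- y                            ∎)
    where
    r = (w ℤ.* y) %ℕ p
    q = (w ℤ.* y) /ℕ p
    open ℤ∣.∣-Reasoning
    expand : ∀ U W Y Q P → (U ℤ.* W ℤ.- 1ℤ) ℤ.* Y ℤ.- U ℤ.* Q ℤ.* P ≡ U ℤ.* (W ℤ.* Y) ℤ.- Y ℤ.- U ℤ.* Q ℤ.* P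
    expand = solve-∀
    collapse : ∀ U R Q P Y → U ℤ.* (R ℤ.+ Q ℤ.* P) ℤ.- Y ℤ.- U ℤ.* Q ℤ.* P ≡ U ℤ.* R ℤ.- Y
    collapse = solve-∀

digit-residue : (p : ℕ) .{{_ : NonZero p}} (β : ℚ) (e r : ℕ) → ℕ
digit-residue p β e r =
  _%ℕ_ (+ (_/_ (↧ₙ β) (p ^ e) {{ℕP.m^n≢0 p e}}) ℤ.* + r ℤ.- ↥ β) (p ^ suc e) {{ℕP.m^n≢0 p (suc e)}}

ω-digit : (p : ℕ) .{{_ : NonZero p}} (β : ℚ) (e : ℕ) → vₚ p (↧ₙ β) ≡ e →
          ∀ {r₀} → r₀ < p ^ suc e → digit-residue p β e r₀ ≡ 0 →
          ∃[ r ] r < p ^ suc e × digit-residue p β e r ≡ 0 × ωₚ p β ≡ _/_ r (p ^ e) {{ℕP.m^n≢0 p e}}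
ω-digit p β .(vₚ p (↧ₙ β)) refl r₀<M r₀-solves
  with find-complete (λ r → digit-residue p β (vₚ p (↧ₙ β)) r ℕ.≟ 0) (∈-upTo⁺ r₀<M) r₀-solves
... | r , found , r∈ , r-solves rewrite found = r , ∈-upTo⁻ r∈ , r-solves , refl

digit-residue-unit : (p : ℕ) .{{_ : NonZero p}} (β : ℚ) (r : ℕ) →
  digit-residue p β 0 r ≡ 0 ⇔ + p ℤ∣.∣ + ↧ₙ β ℤ.* + r ℤ.- ↥ β
digit-residue-unit p β r = mk⇔
  (λ res≡0 → subst₂ (λ M z → + M ℤ∣.∣ z) p*1≡p z≡ (%ℕ≡0⇒∣ _ (p * 1) {{ℕP.m^n≢0 p 1}} res≡0))
  (λ p∣z → ∣⇒%ℕ≡0 _ (p * 1) {{ℕP.m^n≢0 p 1}} (subst₂ (λ M z → + M ℤ∣.∣ z) (sym p*1≡p) (sym z≡) p∣z))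
  where
  p*1≡p = ℕP.*-identityʳ p
  z≡ : + (↧ₙ β / 1) ℤ.* + r ℤ.- ↥ β ≡ + ↧ₙ β ℤ.* + r ℤ.- ↥ β
  z≡ = cong (λ d → + d ℤ.* + r ℤ.- ↥ β) (n/1≡n (↧ₙ β))

/-≃ : ∀ {i j} m n .{{_ : NonZero m}} .{{_ : NonZero n}} →
      i ℤ.* + n ≡ j ℤ.* + m → i /ᵘ m ≃ j /ᵘ n
/-≃ (suc _) (suc _) eq = *≡* eq

/-* : ∀ i j m n .{{_ : NonZero m}} .{{_ : NonZero n}} →
      (i /ᵘ m) ℚᵘ.* (j /ᵘ n) ≡ _/ᵘ_ (i ℤ.* j) (m * n) {{ℕP.m*n≢0 m n}}
/-* i j (suc _) (suc _) = refl

/-+ : ∀ i j m n .{{_ : NonZero m}} .{{_ : NonZero n}} →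
      (i /ᵘ m) ℚᵘ.+ (j /ᵘ n) ≡ _/ᵘ_ (i ℤ.* + n ℤ.+ j ℤ.* + m) (m * n) {{ℕP.m*n≢0 m n}}
/-+ i j (suc _) (suc _) = refl

/-neg : ∀ i m .{{_ : NonZero m}} → ℚᵘ.- (i /ᵘ m) ≡ (ℤ.- i) /ᵘ m
/-neg i (suc _) = refl

toℚᵘ-/ : ∀ i m .{{_ : NonZero m}} → toℚᵘ (i ℚ./ m) ≃ i /ᵘ m
toℚᵘ-/ i (suc m) = ℚP.toℚᵘ-fromℚᵘ (mkℚᵘ i m)

fraction : (i : ℤ) (u : ℕ) .{{_ : NonZero u}} → .(Coprime ℤ.∣ i ∣ u) → ℚ
fraction i (suc u₁) i⊥u = mkℚ i u₁ i⊥u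

toℚᵘ-fraction : ∀ i u .{{_ : NonZero u}} .(i⊥u : Coprime ℤ.∣ i ∣ u) → toℚᵘ (fraction i u i⊥u) ≡ i /ᵘ u
toℚᵘ-fraction i (suc _) _ = refl

powℚ-≃ : ∀ p .{{_ : NonZero p}} a e →
         toℚᵘ (powℚ p (+ a ℤ.- + e)) ≃ _/ᵘ_ (+ (p ^ a)) (p ^ e) {{ℕP.m^n≢0 p e}}
powℚ-≃ p a e with ℕP.≤-<-connex e a
... | inj₁ e≤a = begin
  toℚᵘ (powℚ p (+ a ℤ.- + e))  ≡⟨ cong (toℚᵘ ∘ powℚ p) (trans (ℤP.[+m]-[+n]≡m⊖n a e) (ℤP.⊖-≥ e≤a)) ⟩
  toℚᵘ (powℚ p (+ (a ∸ e)))    ≈⟨ toℚᵘ-/ (+ (p ^ (a ∸ e))) 1 ⟩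
  + (p ^ (a ∸ e)) /ᵘ 1         ≈⟨ /-≃ 1 (p ^ e) {{_}} {{ℕP.m^n≢0 p e}} (pos-*-≡ (p ^ (a ∸ e)) (p ^ e) (p ^ a) 1 pᵃ⁻ᵉ*pᵉ≡pᵃ*1) ⟩
  _/ᵘ_ (+ (p ^ a)) (p ^ e) {{ℕP.m^n≢0 p e}} ∎
  where
  open ℚᵘP.≃-Reasoning
  pᵃ⁻ᵉ*pᵉ≡pᵃ*1 : p ^ (a ∸ e) * p ^ e ≡ p ^ a * 1
  pᵃ⁻ᵉ*pᵉ≡pᵃ*1 = trans (sym (ℕP.^-distribˡ-+-* p (a ∸ e) e))
                       (trans (cong (p ^_) (ℕP.m∸n+n≡m e≤a)) (sym (ℕP.*-identityʳ (p ^ a))))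
... | inj₂ a<e with ℕP.m≤n⇒∃[o]m+o≡n a<e
...   | o , refl = begin
  toℚᵘ (powℚ p (+ a ℤ.- + (suc a + o))) ≡⟨ cong (toℚᵘ ∘ powℚ p) a-[a+1+o]≡-[1+o] ⟩
  toℚᵘ (powℚ p -[1+ o ])               ≈⟨ toℚᵘ-/ (+ 1) (p ^ suc o) {{ℕP.m^n≢0 p (suc o)}} ⟩
  _/ᵘ_ (+ 1) (p ^ suc o) {{ℕP.m^n≢0 p (suc o)}}
    ≈⟨ /-≃ (p ^ suc o) (p ^ (suc a + o)) {{ℕP.m^n≢0 p (suc o)}} {{ℕP.m^n≢0 p (suc a + o)}} (pos-*-≡ 1 (p ^ (suc a + o)) (p ^ a) (p ^ suc o) 1*pᵃ⁺¹⁺ᵒ≡pᵃ*pᵒ⁺¹) ⟩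
  _/ᵘ_ (+ (p ^ a)) (p ^ (suc a + o)) {{ℕP.m^n≢0 p (suc a + o)}} ∎
  where
  open ℚᵘP.≃-Reasoning
  a-[a+1+o]≡-[1+o] : + a ℤ.- + (suc a + o) ≡ -[1+ o ]
  a-[a+1+o]≡-[1+o] = trans (ℤP.[+m]-[+n]≡m⊖n a (suc a + o))
    (trans (ℤP.⊖-< a<e) (cong (λ k → ℤ.- + k) (trans (cong (_∸ a) (sym (ℕP.+-suc a o))) (ℕP.m+n∸m≡n a (suc o)))))
  1*pᵃ⁺¹⁺ᵒ≡pᵃ*pᵒ⁺¹ : 1 * p ^ (suc a + o) ≡ p ^ a * p ^ suc o
  1*pᵃ⁺¹⁺ᵒ≡pᵃ*pᵒ⁺¹ = trans (ℕP.*-identityˡ _) (trans (cong (p ^_) (sym (ℕP.+-suc a o))) (ℕP.^-distribˡ-+-* p a (suc o)))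

-- Size estimates for one step of T, in terms of d = ↧α, its p-free part d' ≤ d,
-- u = p-free part of |↥α|, and the digit c < p.
digit-mult-bound : ∀ {c p} u → c < p → u + c * u ≤ p * u
digit-mult-bound u c<p = ℕP.*-monoˡ-≤ u c<p

positive-step-bound : ∀ {d d' c p} u → d' ≤ d → c < p → u + (d' + c * u) ≤ d + p * u
positive-step-bound {d} {d'} {c} {p} u d'≤d c<p = begin
  u + (d' + c * u)  ≡⟨ ℕP.+-comm u (d' + c * u) ⟩
  d' + c * u + u    ≡⟨ ℕP.+-assoc d' (c * u) u ⟩
  d' + (c * u + u)  ≡⟨ cong (λ t → d' + t) (ℕP.+-comm (c * u) u) ⟩
  d' + (u + c * u)  ≤⟨ ℕP.+-mono-≤ d'≤d (digit-mult-bound u c<p) ⟩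
  d + p * u         ∎
  where open ℕP.≤-Reasoning

negative-step-bound : ∀ {d d' c p} u → d' ≤ d → 0 < d → 1 < p → 0 < u → c < p →
                      u + (d' ℕ.⊔ c * u) < d + p * u
negative-step-bound {d} {d'} {c} {p} u d'≤d 0<d 1<p 0<u c<p =
  subst (_< d + p * u) (sym (ℕP.+-distribˡ-⊔ u d' (c * u))) (ℕP.⊔-lub u+d'< u+cu<)
  where
  u<p*u : u < p * u
  u<p*u = subst (u <_) (ℕP.*-comm u p) (ℕP.m<m*n u p {{ℕ.>-nonZero 0<u}} 1<p)
  u+d'< : u + d' < d + p * u
  u+d'< = subst (_< d + p * u) (ℕP.+-comm d' u) (ℕP.+-mono-≤-< d'≤d u<p*u)
  u+cu< : u + c * u < d + p * u
  u+cu< = ℕP.≤-<-trans (digit-mult-bound u c<p) (ℕP.m<n+m (p * u) 0<d)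

-- Doubling leaves room for a sign bit s ≤ 1.
double-≤ : ∀ {a b} → a ≤ b → 2 * a + 0 < 2 * b + 1
double-≤ a≤b = ℕP.+-mono-≤-< (ℕP.*-monoʳ-≤ 2 a≤b) (s≤s z≤n)

double-< : ∀ {a b s} → a < b → s ≤ 1 → 2 * a + s < 2 * b + 0
double-< {a} {b} {s} a<b s≤1 = begin-strict
  2 * a + s      ≤⟨ ℕP.+-monoʳ-≤ (2 * a) s≤1 ⟩
  2 * a + 1      <⟨ ℕP.+-monoʳ-< (2 * a) (ℕP.n<1+n 1) ⟩
  2 * a + 2      ≡⟨ ℕP.+-comm (2 * a) 2 ⟩
  2 + 2 * a      ≡⟨ ℕP.*-distribˡ-+ 2 1 a ⟨
  2 * suc a      ≤⟨ ℕP.*-monoʳ-≤ 2 a<b ⟩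
  2 * b          ≡⟨ ℕP.+-identityʳ (2 * b) ⟨
  2 * b + 0      ∎
  where open ℕP.≤-Reasoning

positive : ℤ → ℕ
positive +[1+ _ ] = 1
positive _        = 0

positive≤1 : ∀ z → positive z ≤ 1
positive≤1 (+ zero)   = z≤n
positive≤1 +[1+ _ ]   = s≤s z≤n
positive≤1 -[1+ _ ]   = z≤n

positive-neg : ∀ n → positive (ℤ.- + n) ≡ 0
positive-neg zero    = refl
positive-neg (suc _) = refl

numerator-after-positive : ∀ d c u → ℤ.- (1ℤ ℤ.* + d) ℤ.- + c ℤ.* + u ≡ ℤ.- + (d + c * u)
numerator-after-positive d c u = begin
  ℤ.- (1ℤ ℤ.* + d) ℤ.- + c ℤ.* + u ≡⟨ regroup (+ d) (+ c) (+ u) ⟩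
  ℤ.- (+ d ℤ.+ + c ℤ.* + u)        ≡⟨ cong (λ t → ℤ.- (+ d ℤ.+ t)) (ℤP.pos-* c u) ⟨
  ℤ.- + (d + c * u)                ∎
  where
  open ≡-Reasoning
  regroup : ∀ D C U → ℤ.- (1ℤ ℤ.* D) ℤ.- C ℤ.* U ≡ ℤ.- (D ℤ.+ C ℤ.* U)
  regroup = solve-∀

numerator-after-negative : ∀ d c u → ℤ.- (ℤ.-1ℤ ℤ.* + d) ℤ.- + c ℤ.* + u ≡ d ℤ.⊖ c * u
numerator-after-negative d c u = begin
  ℤ.- (ℤ.-1ℤ ℤ.* + d) ℤ.- + c ℤ.* + u ≡⟨ regroup (+ d) (+ c) (+ u) ⟩
  + d ℤ.- + c ℤ.* + u                 ≡⟨ cong (λ t → + d ℤ.- t) (ℤP.pos-* c u) ⟨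
  + d ℤ.- + (c * u)                   ≡⟨ ℤP.[+m]-[+n]≡m⊖n d (c * u) ⟩
  d ℤ.⊖ c * u                         ∎
  where
  open ≡-Reasoning
  regroup : ∀ D C U → ℤ.- (ℤ.-1ℤ ℤ.* D) ℤ.- C ℤ.* U ≡ D ℤ.- C ℤ.* U
  regroup = solve-∀

module Descent (p : ℕ) .{{_ : NonZero p}} (p-prime : Prime p) where

  1<p : 1 < p
  1<p = ℕ.nonTrivial⇒n>1 p {{prime⇒nonTrivial p-prime}}

  open Valuation p 1<p
  open Residues p p-prime

  ω-unit : (β : ℚ) → ¬ p ∣ ↧ₙ β →
           ∃[ c ] c < p × + p ℤ∣.∣ + ↧ₙ β ℤ.* + c ℤ.- ↥ β × ωₚ p β ≡ c
  ω-unit β p∤d =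
    let r₀ , r₀<p , r₀-solves = residue p∤d (↥ β)
        r₀<p¹ : r₀ < p ^ 1
        r₀<p¹ = subst (r₀ <_) (sym (ℕP.*-identityʳ p)) r₀<p
        v≡0 : vₚ p (↧ₙ β) ≡ 0
        v≡0 = vₚ-unit (s≤s z≤n) p∤d
        c , c<p¹ , c-solves , ω≡c/1 =
          ω-digit p β 0 v≡0 r₀<p¹ (Equivalence.from (digit-residue-unit p β r₀) r₀-solves)
    in  c , subst (c <_) (ℕP.*-identityʳ p) c<p¹ ,
        Equivalence.to (digit-residue-unit p β c) c-solves , trans ω≡c/1 (n/1≡n c)

  subtract-digit : ℚ → ℚ
  subtract-digit β = β ℚ.- (+ ωₚ p β) ℚ./ 1

  subtract-digit-fraction : ∀ i u .{{_ : NonZero u}} (i⊥u : Coprime ℤ.∣ i ∣ u) → ¬ p ∣ u →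
    ∃[ c ] c < p × + p ℤ∣.∣ i ℤ.- + c ℤ.* + u ×
           ↥ subtract-digit (fraction i u i⊥u) ≡ i ℤ.- + c ℤ.* + u ×
           ↧ₙ subtract-digit (fraction i u i⊥u) ≡ u
  subtract-digit-fraction i u@(suc u₁) i⊥u p∤u = c , c<p , p∣x , cong ↥_ value , cong ↧ₙ_ value
    where
    β = mkℚ i u₁ i⊥u
    digit = ω-unit β p∤u
    c = proj₁ digit
    c<p = proj₁ (proj₂ digit)
    p∣uc-i = proj₁ (proj₂ (proj₂ digit))
    ω≡c = proj₂ (proj₂ (proj₂ digit))
    x = i ℤ.- + c ℤ.* + u
    p∣x : + p ℤ∣.∣ x
    p∣x = subst (+ p ℤ∣.∣_) (flip-difference (+ u) (+ c) i) (∣m⇒∣-m p∣uc-i)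
      where
      flip-difference : ∀ U C I → ℤ.- (U ℤ.* C ℤ.- I) ≡ I ℤ.- C ℤ.* U
      flip-difference = solve-∀
    value : subtract-digit β ≡ mkℚ x u₁ (coprime-shift i c u i⊥u)
    value = ℚP.toℚᵘ-injective (begin
      toℚᵘ (β ℚ.- (+ ωₚ p β) ℚ./ 1)                ≈⟨ ℚP.toℚᵘ-homo-+ β (ℚ.- ((+ ωₚ p β) ℚ./ 1)) ⟩
      toℚᵘ β ℚᵘ.+ toℚᵘ (ℚ.- ((+ ωₚ p β) ℚ./ 1))    ≈⟨ ℚᵘP.+-congʳ (toℚᵘ β) (ℚP.toℚᵘ-homo‿- ((+ ωₚ p β) ℚ./ 1)) ⟩
      toℚᵘ β ℚᵘ.+ ℚᵘ.- toℚᵘ ((+ ωₚ p β) ℚ./ 1)     ≈⟨ ℚᵘP.+-congʳ (toℚᵘ β) (ℚᵘP.-‿cong (toℚᵘ-/ (+ ωₚ p β) 1)) ⟩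
      i /ᵘ u ℚᵘ.+ (ℤ.- + ωₚ p β) /ᵘ 1              ≡⟨ /-+ i (ℤ.- + ωₚ p β) u 1 ⟩
      (i ℤ.* + 1 ℤ.+ ℤ.- + ωₚ p β ℤ.* + u) /ᵘ (u * 1) ≈⟨ /-≃ (u * 1) u (cross (ωₚ p β) ω≡c) ⟩
      x /ᵘ u                                        ∎)
      where
      open ℚᵘP.≃-Reasoning
      regroup : ∀ I C U → (I ℤ.* + 1 ℤ.+ ℤ.- C ℤ.* U) ℤ.* U ≡ (I ℤ.- C ℤ.* U) ℤ.* (U ℤ.* + 1)
      regroup = solve-∀
      cross : ∀ w → w ≡ c → (i ℤ.* + 1 ℤ.+ ℤ.- + w ℤ.* + u) ℤ.* + u ≡ x ℤ.* + (u * 1)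
      cross _ refl = trans (regroup i (+ c) (+ u)) (cong (x ℤ.*_) (sym (ℤP.pos-* u 1)))


  β-of : (α : ℚ) → α ≢ 0ℚ → ℚ
  β-of α α≢0 = ℚ.- (ℚ._÷_ (powℚ p (ordₚ p α)) α {{ℚ.≢-nonZero α≢0}})

  -- Away from 0, T is "β(α) minus its digit".  (Splitting on the sign of the
  -- numerator lets α ≟ 0ℚ compute.)
  T-nonzero : ∀ α (α≢0 : α ≢ 0ℚ) → T p α ≡ subtract-digit (β-of α α≢0)
  T-nonzero (mkℚ (+ 0)    _ _) α≢0 = ⊥-elim (α≢0 (ℚP.↥p≡0⇒p≡0 _ refl))
  T-nonzero (mkℚ +[1+ _ ] _ _) α≢0 = refl
  T-nonzero (mkℚ -[1+ _ ] _ _) α≢0 = refl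

  numerator-nonZero : ∀ α → α ≢ 0ℚ → NonZero ℤ.∣ ↥ α ∣
  numerator-nonZero (mkℚ _ _ _) α≢0 = ℚ.≢-nonZero α≢0

  numerator-pos : ∀ α → α ≢ 0ℚ → 0 < ℤ.∣ ↥ α ∣
  numerator-pos α α≢0 = ℕ.>-nonZero⁻¹ _ {{numerator-nonZero α α≢0}}

  -- Writing |↥α| = u·p^a and ↧α = d'·p^e (u, d' prime to p), and 1/α = σ·↧α/|↥α|,
  -- the factors p^a, p^e cancel: β(α) = -σ·d'/u.
  β-value : (α : ℚ) (α≢0 : α ≢ 0ℚ) (σ : ℤ) →
    toℚᵘ (ℚ.1/_ α {{ℚ.≢-nonZero α≢0}}) ≃ _/ᵘ_ (σ ℤ.* + ↧ₙ α) ℤ.∣ ↥ α ∣ {{numerator-nonZero α α≢0}} →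
    toℚᵘ (β-of α α≢0) ≃
      _/ᵘ_ (ℤ.- (σ ℤ.* + unit (↧ₙ α))) (unit ℤ.∣ ↥ α ∣) {{unit-nonZero (numerator-pos α α≢0)}}
  β-value α α≢0 σ 1/α≃σD/N = begin
    toℚᵘ (ℚ.- (P ℚ.* R))                      ≈⟨ ℚP.toℚᵘ-homo‿- (P ℚ.* R) ⟩
    ℚᵘ.- toℚᵘ (P ℚ.* R)                       ≈⟨ ℚᵘP.-‿cong (ℚP.toℚᵘ-homo-* P R) ⟩
    ℚᵘ.- (toℚᵘ P ℚᵘ.* toℚᵘ R)                 ≈⟨ ℚᵘP.-‿cong (ℚᵘP.*-cong (powℚ-≃ p a e) 1/α≃σD/N) ⟩
    ℚᵘ.- ((+ (p ^ a) /ᵘ p ^ e) ℚᵘ.* ((σ ℤ.* + D) /ᵘ N))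
      ≡⟨ cong ℚᵘ.-_ (/-* (+ (p ^ a)) (σ ℤ.* + D) (p ^ e) N) ⟩
    ℚᵘ.- ((+ (p ^ a) ℤ.* (σ ℤ.* + D)) /ᵘ (p ^ e * N))
      ≡⟨ /-neg (+ (p ^ a) ℤ.* (σ ℤ.* + D)) (p ^ e * N) ⟩
    (ℤ.- (+ (p ^ a) ℤ.* (σ ℤ.* + D))) /ᵘ (p ^ e * N)
      ≈⟨ /-≃ (p ^ e * N) u cross ⟩
    (ℤ.- (σ ℤ.* + d')) /ᵘ u                   ∎
    where
    instance
      α≢0′ = ℚ.≢-nonZero α≢0
      N≢0 = numerator-nonZero α α≢0
      pᵉ≢0 = ℕP.m^n≢0 p (vₚ p (↧ₙ α))
      pᵉN≢0 = ℕP.m*n≢0 (p ^ vₚ p (↧ₙ α)) ℤ.∣ ↥ α ∣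
      u≢0 = unit-nonZero (numerator-pos α α≢0)
    open ℚᵘP.≃-Reasoning
    P = powℚ p (ordₚ p α)
    R = ℚ.1/ α
    N = ℤ.∣ ↥ α ∣
    D = ↧ₙ α
    u = unit N
    d' = unit D
    a = vₚ p N
    e = vₚ p D
    cancel : ∀ A σ D' E U → ℤ.- (A ℤ.* (σ ℤ.* (D' ℤ.* E))) ℤ.* U ≡ ℤ.- (σ ℤ.* D') ℤ.* (E ℤ.* (U ℤ.* A))
    cancel = solve-∀
    cross : ℤ.- (+ (p ^ a) ℤ.* (σ ℤ.* + D)) ℤ.* + u ≡ ℤ.- (σ ℤ.* + d') ℤ.* + (p ^ e * N)
    cross = ≡.begin
      ℤ.- (+ (p ^ a) ℤ.* (σ ℤ.* + D)) ℤ.* + u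
        ≡.≡⟨ cong (λ t → ℤ.- (+ (p ^ a) ℤ.* (σ ℤ.* t)) ℤ.* + u)
                  (trans (cong +_ (proj₁ (unit-factorisation (s≤s z≤n)))) (ℤP.pos-* d' (p ^ e))) ⟩
      ℤ.- (+ (p ^ a) ℤ.* (σ ℤ.* (+ d' ℤ.* + (p ^ e)))) ℤ.* + u
        ≡.≡⟨ cancel (+ (p ^ a)) σ (+ d') (+ (p ^ e)) (+ u) ⟩
      ℤ.- (σ ℤ.* + d') ℤ.* (+ (p ^ e) ℤ.* (+ u ℤ.* + (p ^ a)))
        ≡.≡⟨ cong (λ t → ℤ.- (σ ℤ.* + d') ℤ.* (+ (p ^ e) ℤ.* t))
                  (trans (sym (ℤP.pos-* u (p ^ a))) (cong +_ (sym (proj₁ (unit-factorisation (numerator-pos α α≢0)))))) ⟩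
      ℤ.- (σ ℤ.* + d') ℤ.* (+ (p ^ e) ℤ.* + N)
        ≡.≡⟨ cong (ℤ.- (σ ℤ.* + d') ℤ.*_) (ℤP.pos-* (p ^ e) N) ⟨
      ℤ.- (σ ℤ.* + d') ℤ.* + (p ^ e * N) ≡.∎
      where module ≡ = ≡-Reasoning

  T-value : (α : ℚ) (α≢0 : α ≢ 0ℚ) (σ : ℤ) → ℤ.∣ σ ∣ ≡ 1 →
    toℚᵘ (ℚ.1/_ α {{ℚ.≢-nonZero α≢0}}) ≃ _/ᵘ_ (σ ℤ.* + ↧ₙ α) ℤ.∣ ↥ α ∣ {{numerator-nonZero α α≢0}} →
    ∃[ c ] c < p ×
      let x = ℤ.- (σ ℤ.* + unit (↧ₙ α)) ℤ.- + c ℤ.* + unit ℤ.∣ ↥ α ∣ in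
      + p ℤ∣.∣ x × ↥ T p α ≡ x × ↧ₙ T p α ≡ unit ℤ.∣ ↥ α ∣
  T-value α@(mkℚ n _ n⊥d) α≢0 σ ∣σ∣≡1 1/α≃σD/N =
    let c , c<p , p∣x , ↥≡x , ↧≡u = subtract-digit-fraction i u i⊥u p∤u
    in  c , c<p , p∣x , trans (cong ↥_ Tα≡) ↥≡x , trans (cong ↧ₙ_ Tα≡) ↧≡u
    where
    instance u≢0 = unit-nonZero (numerator-pos α α≢0)
    u = unit ℤ.∣ n ∣
    d' = unit (↧ₙ α)
    i = ℤ.- (σ ℤ.* + d')
    ∣i∣≡d' : ℤ.∣ i ∣ ≡ d'
    ∣i∣≡d' = trans (ℤP.∣-i∣≡∣i∣ (σ ℤ.* + d'))
               (trans (ℤP.abs-* σ (+ d')) (trans (cong (_* d') ∣σ∣≡1) (ℕP.*-identityˡ d')))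
    i⊥u : Coprime ℤ.∣ i ∣ u
    i⊥u = subst (λ k → Coprime k u) (sym ∣i∣≡d')
            (coprime-divisors (Coprimality.sym (Coprimality.recompute n⊥d))
                              (unit-∣ (s≤s z≤n)) (unit-∣ (numerator-pos α α≢0)))
    p∤u : ¬ p ∣ u
    p∤u = proj₂ (unit-factorisation (numerator-pos α α≢0))
    Tα≡ : T p α ≡ subtract-digit (fraction i u i⊥u)
    Tα≡ = trans (T-nonzero α α≢0) (cong subtract-digit (ℚP.toℚᵘ-injective
            (ℚᵘP.≃-trans (β-value α α≢0 σ 1/α≃σD/N) (ℚᵘP.≃-reflexive (sym (toℚᵘ-fraction i u i⊥u))))))

  μ : ℚ → ℕ
  μ α = 2 * (↧ₙ α + p * unit ℤ.∣ ↥ α ∣) + positive (↥ α)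

  -- If p divides the numerator x, its p-free part contributes at most |x| to μ.
  μ-bound : ∀ β {x u} → ↥ β ≡ x → ↧ₙ β ≡ u → + p ℤ∣.∣ x → μ β ≤ 2 * (u + ℤ.∣ x ∣) + positive x
  μ-bound β refl refl p∣x = ℕP.+-monoˡ-≤ (positive (↥ β))
    (ℕP.*-monoʳ-≤ 2 (ℕP.+-monoʳ-≤ (↧ₙ β) (p*unit≤ ℤ.∣ ↥ β ∣ (∣⇒∣ᵤ p∣x))))

  descent : ∀ α → α ≢ 0ℚ → μ (T p α) < μ α
  descent (mkℚ (+ 0) _ _) α≢0 = ⊥-elim (α≢0 (ℚP.↥p≡0⇒p≡0 _ refl))
  -- n > 0: T α = -(d' + c·u)/u is negative; the non-strict size estimate is
  -- made strict by the lost sign bit.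
  descent α@(mkℚ +[1+ m ] d-1 _) α≢0 =
    let c , c<p , p∣x , ↥T≡x , ↧T≡u = T-value α α≢0 1ℤ refl 1/α≃
        x≡ = numerator-after-positive d' c u
    in begin-strict
      μ (T p α)                                   ≤⟨ μ-bound (T p α) ↥T≡x ↧T≡u p∣x ⟩
      2 * (u + ℤ.∣ ℤ.- (1ℤ ℤ.* + d') ℤ.- + c ℤ.* + u ∣) + positive (ℤ.- (1ℤ ℤ.* + d') ℤ.- + c ℤ.* + u)
        ≡⟨ cong₂ (λ a b → 2 * (u + a) + b) (trans (cong ℤ.∣_∣ x≡) (ℤP.∣-i∣≡∣i∣ (+ (d' + c * u))))
                                           (trans (cong positive x≡) (positive-neg (d' + c * u))) ⟩
      2 * (u + (d' + c * u)) + 0                  <⟨ double-≤ (positive-step-bound u (unit-≤ (suc d-1)) c<p) ⟩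
      2 * (suc d-1 + p * u) + 1                   ∎
    where
    open ℕP.≤-Reasoning
    u = unit (suc m)
    d' = unit (suc d-1)
    1/α≃ = ℚᵘP.≃-reflexive (cong (λ t → mkℚᵘ t m) (sym (ℤP.*-identityˡ +[1+ d-1 ])))
  -- n < 0: T α = (d' - c·u)/u and the size estimate is strict, leaving room for
  -- a possible new sign bit.
  descent α@(mkℚ -[1+ m ] d-1 _) α≢0 =
    let c , c<p , p∣x , ↥T≡x , ↧T≡u = T-value α α≢0 ℤ.-1ℤ refl 1/α≃
        x = ℤ.- (ℤ.-1ℤ ℤ.* + d') ℤ.- + c ℤ.* + u
        ∣x∣≤ : ℤ.∣ x ∣ ≤ d' ℕ.⊔ c * u
        ∣x∣≤ = subst (λ t → ℤ.∣ t ∣ ≤ d' ℕ.⊔ c * u) (sym (numerator-after-negative d' c u))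
                     (ℤP.∣m⊝n∣≤m⊔n d' (c * u))
    in begin-strict
      μ (T p α)                           ≤⟨ μ-bound (T p α) ↥T≡x ↧T≡u p∣x ⟩
      2 * (u + ℤ.∣ x ∣) + positive x      ≤⟨ ℕP.+-monoˡ-≤ (positive x) (ℕP.*-monoʳ-≤ 2 (ℕP.+-monoʳ-≤ u ∣x∣≤)) ⟩
      2 * (u + (d' ℕ.⊔ c * u)) + positive x
        <⟨ double-< (negative-step-bound u (unit-≤ (suc d-1)) (s≤s z≤n) 1<p
                       (ℕ.>-nonZero⁻¹ u {{unit-nonZero (s≤s (z≤n {m}))}}) c<p) (positive≤1 x) ⟩
      2 * (suc d-1 + p * u) + 0           ∎
    where
    open ℕP.≤-Reasoning
    u = unit (suc m)
    d' = unit (suc d-1)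
    1/α≃ = ℚᵘP.≃-reflexive (cong (λ t → mkℚᵘ t m) (sym (ℤP.-1*i≡-i +[1+ d-1 ])))

proposition3 : (p : ℕ) .{{_ : NonZero p}} → Prime p →
                 (α : ℚ) → ∃[ m ] iter (T p) m α ≡ 0ℚ
proposition3 p p-prime = iter-reaches (T p) 0ℚ (ℚP._≟ 0ℚ) μ descent
  where open Descent p p-prime
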